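{- Let $G$ be a graph, let $\ell\geq 1$, and let $B\subseteq V(G)$. Then $B$ is a specified $\ell$-leaky forcing set of $G$ if and only if $B$ is an $(\ell-1)$-leaky forcing set of $G$ such that for every set $L$ of $\ell-1$ vertex leaks and every $v\in V(G)\setminus B$, there exist forces $x\rightarrow v,\ y\rightarrow v\in \mathcal{F}_L(B)$ with $y\neq x$.
   Context: All graphs are finite simple graphs. Given a graph $G$ and a set $B\subseteq V(G)$ of initially blue vertices (all other vertices white), the zero forcing color-change rule says: if a blue vertex $u$ has exactly one white neighbor $w$, then $u$ may force $w$, i.e. color $w$ blue (written $u\rightarrow w$, a force). A vertex leak is a vertex that is not allowed to perform any force. A set $B$ is an $\ell$-leaky forcing set of $G$ if for every set $L\subseteq V(G)$ of $\ell$ vertex leaks, exhaustively applying the color-change rule from $B$ (with vertices of $L$ never forcing) turns all of $G$ blue. For a set $L$ of vertex leaks, a forcing process of $B$ with leaks $L$ is a set of forces, none performed by a vertex of $L$, admitting a chronological ordering in which every force is valid when performed and at the end all of $G$ is blue; $\mathcal{F}_L(B)$ is the set of forces $u\rightarrow v$ belonging to some such forcing process. A specified leak $v\rightarrow u$ (for adjacent $v,u$) prohibits the single force of $v$ forcing $u$. A set $B$ is a specified $\ell$-leaky forcing set of $G$ if $B$ can color all of $G$ blue whenever any set of $\ell$ forces is prohibited (i.e. for every set of $\ell$ specified leaks). -}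

module Defs where

open import Data.Nat using (ℕ; _≤_)
open import Data.Fin using (Fin)
open import Data.Fin.Subset using (Subset; _∈_; _∉_; ∣_∣)
open import Data.Bool using (Bool; T)
open import Data.Product using (_×_; _,_; proj₂; ∃; ∃-syntax)
open import Data.Sum using (_⊎_)
open import Data.List using (List; []; _∷_; length)
open import Data.List.Relation.Unary.Any using (Any)
open import Data.List.Relation.Unary.All using (All)
open import Relation.Binary.PropositionalEquality using (_≡_; _≢_)
open import Relation.Nullary using (¬_)

record Graph (n : ℕ) : Set where
  field
    adj   : Fin n → Fin n → Bool
    sym   : ∀ u v → adj u v ≡ adj v u
    irrefl : ∀ u → adj u u ≡ Data.Bool.false

open Graph public

Adj : ∀ {n} → Graph n → Fin n → Fin n → Set
Adj G u v = T (adj G u v)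

-- A force u → w is represented as the ordered pair (u , w).
Force : ℕ → Set
Force n = Fin n × Fin n

Blue : ∀ {n} → Subset n → List (Force n) → Fin n → Set
Blue B fs v = v ∈ B ⊎ Any (λ f → proj₂ f ≡ v) fs

CanForce : ∀ {n} → Graph n → (Fin n → Fin n → Set) → (Fin n → Set) →
           Fin n → Fin n → Set
CanForce G P blue u w =
  P u w × Adj G u w × blue u × ¬ blue w ×
  (∀ x → Adj G u x → x ≢ w → blue x)

-- A chronologically valid sequence of forces, stored latest-first
-- (head of the list = last force performed).
data Chain {n} (G : Graph n) (P : Fin n → Fin n → Set) (B : Subset n) :
           List (Force n) → Set where
  done : Chain G P B []
  step : ∀ {fs u w} → Chain G P B fs → CanForce G P (Blue B fs) u w →
         Chain G P B ((u , w) ∷ fs)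

Process : ∀ {n} → Graph n → (Fin n → Fin n → Set) → Subset n →
          List (Force n) → Set
Process G P B fs = Chain G P B fs × (∀ v → Blue B fs v)

Forces : ∀ {n} → Graph n → (Fin n → Fin n → Set) → Subset n → Set
Forces G P B = ∃[ fs ] Process G P B fs

NotLeak : ∀ {n} → Subset n → Fin n → Fin n → Set
NotLeak L u w = u ∉ L

NotSpecLeak : ∀ {n} → List (Force n) → Fin n → Fin n → Set
NotSpecLeak S u w = ¬ Any (_≡ (u , w)) S

LeakyForcingSet : ∀ {n} → Graph n → ℕ → Subset n → Set
LeakyForcingSet G ℓ B = ∀ (L : Subset _) → ∣ L ∣ ≤ ℓ → Forces G (NotLeak L) B

SpecLeakyForcingSet : ∀ {n} → Graph n → ℕ → Subset n → Set
SpecLeakyForcingSet G ℓ B =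
  ∀ (S : List (Force _)) → length S ≤ ℓ → All (λ f → Adj G (Data.Product.proj₁ f) (proj₂ f)) S →
  Forces G (NotSpecLeak S) B

InF : ∀ {n} → Graph n → Subset n → Subset n → Fin n → Fin n → Set
InF G L B u v = ∃[ fs ] (Process G (NotLeak L) B fs × Any (_≡ (u , v)) fs)

-- A specified leak v → u is subsumed by a vertex leak at v, and a vertex leak at v only
-- matters through the single force v could still perform once the process stalls.
-- Forwards: run B with ℓ − 1 vertex leaks L and at most one extra specified leak until it
-- stalls, then replace every vertex leak by the specified leak on the force it blocks there;
-- with these ≤ ℓ specified leaks no process gets past the stalled colouring, which is
-- therefore all of G. No extra leak gives (ℓ − 1)-leaky forcing; prohibiting x → v for a
-- forcer x of v yields a second forcer. Backwards: of the specified leaks keep one, a → b,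
-- and turn the others into vertex leaks at their sources; a process for those in which b
-- is initially blue or forced by some z ≠ a never performs a → b, as every vertex is
-- forced at most once.
module Submission where

open import Defs hiding (sym)
open import Data.Nat using (ℕ; _≤_; _∸_; _+_; suc; z≤n; s≤s)
open import Data.Nat.Properties using (≤-trans; ≤-reflexive; +-monoʳ-≤; m≤n⇒m≤1+n; +-suc; module ≤-Reasoning)
open import Data.Fin using (Fin; _≟_) renaming (zero to fzero; suc to fsuc)
open import Data.Fin.Properties using (any?; all?)
open import Data.Fin.Subset using (Subset; _∈_; _∉_; _⊂_; _⊃_; ∣_∣; ⊥; ⁅_⁆; _∪_; inside; outside)
open import Data.Fin.Subset.Properties using (_∈?_; ∣⊥∣≡0; ∣⁅x⁆∣≡1; ∣p∣≤∣x∷p∣; x∈⁅x⁆; x∈p∪q⁺)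
open import Data.Fin.Subset.Induction using (⊃-wellFounded)
open import Data.Vec using ([]; _∷_; here; there; tabulate)
open import Data.Vec.Properties using (lookup⇒[]=; []=⇒lookup; lookup∘tabulate)
open import Data.Empty using (⊥-elim)
open import Data.Product using (_×_; _,_; proj₁; proj₂; ∃-syntax)
open import Data.Product.Properties using (≡-dec)
open import Data.Sum using (inj₁; inj₂)
open import Data.List using (List; []; _∷_; length; _++_; map; foldr)
open import Data.List.Properties using (length-++; length-map)
open import Data.List.Relation.Unary.Any as Any using (Any; here; there)
open import Data.List.Relation.Unary.Any.Properties using (++⁺ˡ; ++⁺ʳ; map⁺)
open import Data.List.Relation.Unary.All using (All; []; _∷_)
open import Data.List.Relation.Unary.All.Properties using (++⁺)
open import Induction.WellFounded using (Acc; acc)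
open import Function using (_∘_)
open import Function.Bundles using (_⇔_; mk⇔)
open import Relation.Binary.PropositionalEquality using (_≡_; _≢_; refl; sym; trans; cong)
open import Relation.Binary.Definitions using (DecidableEquality)
open import Relation.Nullary using (¬_; Dec; yes; no; does)
open import Relation.Nullary.Decidable using (_×-dec_; _⊎-dec_; _→-dec_; ¬?; dec-true; T?)

members : ∀ {n} → Subset n → List (Fin n)
members [] = []
members (inside ∷ p) = fzero ∷ map fsuc (members p)
members (outside ∷ p) = map fsuc (members p)

length-members : ∀ {n} (p : Subset n) → length (members p) ≡ ∣ p ∣
length-members [] = refl
length-members (inside ∷ p) = cong suc (trans (length-map fsuc (members p)) (length-members p))
length-members (outside ∷ p) = trans (length-map fsuc (members p)) (length-members p)

∈-members : ∀ {n} {x : Fin n} {p : Subset n} → x ∈ p → Any (_≡ x) (members p)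
∈-members {p = inside ∷ p} here = here refl
∈-members {p = inside ∷ p} (there x∈p) = there (map⁺ (Any.map (cong fsuc) (∈-members x∈p)))
∈-members {p = outside ∷ p} (there x∈p) = map⁺ (Any.map (cong fsuc) (∈-members x∈p))

∣p∪q∣≤∣p∣+∣q∣ : ∀ {n} (p q : Subset n) → ∣ p ∪ q ∣ ≤ ∣ p ∣ + ∣ q ∣
∣p∪q∣≤∣p∣+∣q∣ [] [] = z≤n
∣p∪q∣≤∣p∣+∣q∣ (inside ∷ p) (s ∷ q) = s≤s (≤-trans (∣p∪q∣≤∣p∣+∣q∣ p q) (+-monoʳ-≤ ∣ p ∣ (∣p∣≤∣x∷p∣ s q)))
∣p∪q∣≤∣p∣+∣q∣ (outside ∷ p) (inside ∷ q) = ≤-trans (s≤s (∣p∪q∣≤∣p∣+∣q∣ p q)) (≤-reflexive (sym (+-suc ∣ p ∣ ∣ q ∣)))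
∣p∪q∣≤∣p∣+∣q∣ (outside ∷ p) (outside ∷ q) = ∣p∪q∣≤∣p∣+∣q∣ p q

module _ {n : ℕ} {P : Fin n → Set} (P? : ∀ x → Dec (P x)) where

  toSubset : Subset n
  toSubset = tabulate (does ∘ P?)

  ∈-toSubset⁺ : ∀ {x} → P x → x ∈ toSubset
  ∈-toSubset⁺ {x} px = lookup⇒[]= x toSubset (trans (lookup∘tabulate (does ∘ P?) x) (dec-true (P? x) px))

  ∈-toSubset⁻ : ∀ {x} → x ∈ toSubset → P x
  ∈-toSubset⁻ {x} x∈ with P? x | trans (sym (lookup∘tabulate (does ∘ P?) x)) ([]=⇒lookup x∈)
  ... | yes px | _ = px
  ... | no _ | ()

NotMixedLeak : ∀ {n} → Subset n → List (Force n) → Fin n → Fin n → Set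
NotMixedLeak L E u w = NotLeak L u w × NotSpecLeak E u w

notMixedLeak? : ∀ {n} (L : Subset n) (E : List (Force n)) u w → Dec (NotMixedLeak L E u w)
notMixedLeak? L E u w = ¬? (u ∈? L) ×-dec ¬? (Any.any? (λ f → ≡-dec _≟_ _≟_ f (u , w)) E)

sources : ∀ {n} → List (Force n) → Subset n
sources = foldr (λ f → ⁅ proj₁ f ⁆ ∪_) ⊥

∣sources∣≤length : ∀ {n} (S : List (Force n)) → ∣ sources S ∣ ≤ length S
∣sources∣≤length {n} [] = ≤-reflexive (∣⊥∣≡0 n)
∣sources∣≤length ((u , _) ∷ S) =
  ≤-trans (∣p∪q∣≤∣p∣+∣q∣ ⁅ u ⁆ (sources S))
          (≤-trans (≤-reflexive (cong (_+ ∣ sources S ∣) (∣⁅x⁆∣≡1 u))) (s≤s (∣sources∣≤length S)))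

∈-sources : ∀ {n} {S : List (Force n)} {u w} → Any (_≡ (u , w)) S → u ∈ sources S
∈-sources {u = u} (here refl) = x∈p∪q⁺ (inj₁ (x∈⁅x⁆ u))
∈-sources (there m) = x∈p∪q⁺ (inj₂ (∈-sources m))

one-of-two-≢ : ∀ {A : Set} {P : A → Set} → DecidableEquality A →
  ∃[ x ] ∃[ y ] (y ≢ x × P x × P y) → ∀ a → ∃[ z ] (z ≢ a × P z)
one-of-two-≢ _≟ᴬ_ (x , y , y≢x , px , py) a with x ≟ᴬ a
... | yes refl = y , y≢x , py
... | no x≢a = x , x≢a , px

module Forcing {n : ℕ} (G : Graph n) (B : Subset n) where

  Stalled : (Fin n → Fin n → Set) → (Fin n → Set) → Set
  Stalled P C = ∀ u w → ¬ CanForce G P C u w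

  blue? : ∀ fs v → Dec (Blue B fs v)
  blue? fs v = (v ∈? B) ⊎-dec Any.any? (λ f → proj₂ f ≟ v) fs

  SoleWhiteNeighbour : (Fin n → Set) → Fin n → Fin n → Set
  SoleWhiteNeighbour C u w = Adj G u w × ¬ C w × (∀ x → Adj G u x → x ≢ w → C x)

  soleWhiteNeighbour? : ∀ {C} → (∀ v → Dec (C v)) → ∀ u w → Dec (SoleWhiteNeighbour C u w)
  soleWhiteNeighbour? C? u w =
    T? (adj G u w) ×-dec ¬? (C? w) ×-dec all? (λ x → T? (adj G u x) →-dec (¬? (x ≟ w) →-dec C? x))

  soleWhiteNeighbour-unique : ∀ {C u w w′} →
    SoleWhiteNeighbour C u w → SoleWhiteNeighbour C u w′ → w ≡ w′
  soleWhiteNeighbour-unique {w = w} {w′} (a , ¬Cw , _) (_ , _ , others′) with w ≟ w′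
  ... | yes w≡w′ = w≡w′
  ... | no w≢w′ = ⊥-elim (¬Cw (others′ w a w≢w′))

  canForce? : ∀ {P C} → (∀ u w → Dec (P u w)) → (∀ v → Dec (C v)) → ∀ u w → Dec (CanForce G P C u w)
  canForce? P? C? u w with P? u w ×-dec C? u ×-dec soleWhiteNeighbour? C? u w
  ... | yes (p , cu , a , ¬cw , others) = yes (p , a , cu , ¬cw , others)
  ... | no ¬can = no λ (p , a , cu , ¬cw , others) → ¬can (p , cu , a , ¬cw , others)

  blueSet : List (Force n) → Subset n
  blueSet fs = toSubset (blue? fs)

  blueSet-grows : ∀ {P fs u w} → CanForce G P (Blue B fs) u w → blueSet fs ⊂ blueSet ((u , w) ∷ fs)
  blueSet-grows {fs = fs} {u} {w} (_ , _ , _ , ¬bw , _) =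
    (λ x∈ → ∈-toSubset⁺ (blue? ((u , w) ∷ fs)) (Blue-∷ (∈-toSubset⁻ (blue? fs) x∈))) ,
    w , ∈-toSubset⁺ (blue? ((u , w) ∷ fs)) (inj₂ (here refl)) , ¬bw ∘ ∈-toSubset⁻ (blue? fs)
    where
      Blue-∷ : ∀ {v} → Blue B fs v → Blue B ((u , w) ∷ fs) v
      Blue-∷ (inj₁ v∈B) = inj₁ v∈B
      Blue-∷ (inj₂ forced) = inj₂ (there forced)

  stalledFrom : ∀ {P} → (∀ u w → Dec (P u w)) → ∀ {fs} → Chain G P B fs → Acc _⊃_ (blueSet fs) →
    ∃[ gs ] (Chain G P B gs × Stalled P (Blue B gs))
  stalledFrom {P} P? {fs} ch (acc rs) with any? (λ u → any? (λ w → canForce? P? (blue? fs) u w))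
  ... | no none = fs , ch , λ u w c → none (u , w , c)
  ... | yes (u , w , c) = stalledFrom P? (step ch c) (rs (blueSet-grows {P = P} c))

  stalledChain : ∀ {P} → (∀ u w → Dec (P u w)) → ∃[ fs ] (Chain G P B fs × Stalled P (Blue B fs))
  stalledChain P? = stalledFrom P? done (⊃-wellFounded _)

  Blue⊆stalled : ∀ {Q C} → (∀ v → Dec (C v)) → (∀ v → v ∈ B → C v) → Stalled Q C →
    ∀ {gs} → Chain G Q B gs → ∀ v → Blue B gs v → C v
  Blue⊆stalled C? B⊆C stalled ch v (inj₁ v∈B) = B⊆C v v∈B
  Blue⊆stalled C? B⊆C stalled (step ch _) v (inj₂ (there forced)) = Blue⊆stalled C? B⊆C stalled ch v (inj₂ forced)
  Blue⊆stalled {C = C} C? B⊆C stalled (step {fs} {u} {w} ch (q , a , bu , _ , others)) v (inj₂ (here refl))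
    with C? w
  ... | yes cw = cw
  ... | no ¬cw = ⊥-elim (stalled u w (q , a , inC u bu , ¬cw , λ x ax x≢w → inC x (others x ax x≢w)))
    where
      inC : ∀ x → Blue B fs x → C x
      inC = Blue⊆stalled C? B⊆C stalled ch

  ∈-chain : ∀ {P fs u w} → Chain G P B fs → Any (_≡ (u , w)) fs → P u w × Adj G u w × w ∉ B
  ∈-chain (step _ (p , a , _ , ¬bw , _)) (here refl) = p , a , ¬bw ∘ inj₁
  ∈-chain (step ch _) (there m) = ∈-chain ch m

  chain-forcer-unique : ∀ {P fs u u′ w} → Chain G P B fs →
    Any (_≡ (u , w)) fs → Any (_≡ (u′ , w)) fs → u ≡ u′
  chain-forcer-unique (step _ _) (here refl) (here refl) = refl
  chain-forcer-unique (step _ (_ , _ , _ , ¬bw , _)) (here refl) (there m′) = ⊥-elim (¬bw (inj₂ (Any.map (cong proj₂) m′)))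
  chain-forcer-unique (step _ (_ , _ , _ , ¬bw , _)) (there m) (here refl) = ⊥-elim (¬bw (inj₂ (Any.map (cong proj₂) m)))
  chain-forcer-unique (step ch _) (there m) (there m′) = chain-forcer-unique ch m m′

  chain-weaken : ∀ {P P′ fs} → Chain G P B fs → (∀ {u w} → Any (_≡ (u , w)) fs → P′ u w) → Chain G P′ B fs
  chain-weaken done _ = done
  chain-weaken (step ch (_ , rest)) permitted = step (chain-weaken ch (permitted ∘ there)) (permitted (here refl) , rest)

  forcerOf : ∀ {fs v} → Blue B fs v → v ∉ B → ∃[ u ] Any (_≡ (u , v)) fs
  forcerOf (inj₁ v∈B) v∉B = ⊥-elim (v∉B v∈B)
  forcerOf (inj₂ (here refl)) _ = _ , here refl
  forcerOf (inj₂ (there forced)) v∉B with forcerOf (inj₂ forced) v∉B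
  ... | u , m = u , there m

  module _ {C : Fin n → Set} (C? : ∀ v → Dec (C v)) where

    escapes : List (Fin n) → List (Force n)
    escapes [] = []
    escapes (u ∷ us) with any? (soleWhiteNeighbour? C? u)
    ... | yes (w , _) = (u , w) ∷ escapes us
    ... | no _ = escapes us

    length-escapes : ∀ us → length (escapes us) ≤ length us
    length-escapes [] = z≤n
    length-escapes (u ∷ us) with any? (soleWhiteNeighbour? C? u)
    ... | yes _ = s≤s (length-escapes us)
    ... | no _ = m≤n⇒m≤1+n (length-escapes us)

    escapes-adjacent : ∀ us → All (λ f → Adj G (proj₁ f) (proj₂ f)) (escapes us)
    escapes-adjacent [] = []
    escapes-adjacent (u ∷ us) with any? (soleWhiteNeighbour? C? u)
    ... | yes (_ , a , _) = a ∷ escapes-adjacent us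
    ... | no _ = escapes-adjacent us

    ∈-escapes : ∀ {u w} us → Any (_≡ u) us → SoleWhiteNeighbour C u w → Any (_≡ (u , w)) (escapes us)
    ∈-escapes (u′ ∷ us) m sole with any? (soleWhiteNeighbour? C? u′) | m
    ... | yes (_ , sole′) | here refl = here (cong (u′ ,_) (soleWhiteNeighbour-unique sole′ sole))
    ... | yes _ | there m′ = there (∈-escapes us m′ sole)
    ... | no none | here refl = ⊥-elim (none (_ , sole))
    ... | no _ | there m′ = ∈-escapes us m′ sole

    length-escapes-members : ∀ E L → length (E ++ escapes (members L)) ≤ length E + ∣ L ∣
    length-escapes-members E L = begin
      length (E ++ escapes (members L))          ≡⟨ length-++ E ⟩
      length E + length (escapes (members L))    ≤⟨ +-monoʳ-≤ (length E) (length-escapes (members L)) ⟩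
      length E + length (members L)              ≡⟨ cong (length E +_) (length-members L) ⟩
      length E + ∣ L ∣                           ∎
      where open ≤-Reasoning

    stalled-escapes : ∀ {L E} → Stalled (NotMixedLeak L E) C →
      Stalled (NotSpecLeak (E ++ escapes (members L))) C
    stalled-escapes {L} {E} stalled u w (q , a , cu , ¬cw , others) =
      stalled u w ((u∉L , q ∘ ++⁺ˡ) , a , cu , ¬cw , others)
      where
        u∉L : u ∉ L
        u∉L u∈L = q (++⁺ʳ E (∈-escapes (members L) (∈-members u∈L) (a , ¬cw , others)))

  dropSpecLeaks : ∀ {L E fs} → Process G (NotMixedLeak L E) B fs → Process G (NotLeak L) B fs
  dropSpecLeaks (ch , all) = chain-weaken ch (proj₁ ∘ proj₁ ∘ ∈-chain ch) , all

  specLeaky⇒mixedLeaky : ∀ {ℓ} → SpecLeakyForcingSet G ℓ B → ∀ L E → length E + ∣ L ∣ ≤ ℓ →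
    All (λ f → Adj G (proj₁ f) (proj₂ f)) E → Forces G (NotMixedLeak L E) B
  specLeaky⇒mixedLeaky spec L E len adjE with stalledChain (notMixedLeak? L E)
  ... | fs , ch , stalled
    with spec (E ++ escapes (blue? fs) (members L))
              (≤-trans (length-escapes-members (blue? fs) E L) len)
              (++⁺ adjE (escapes-adjacent (blue? fs) (members L)))
  ... | _ , sch , sall =
    fs , ch , λ v → Blue⊆stalled (blue? fs) (λ _ → inj₁) (stalled-escapes (blue? fs) stalled) sch v (sall v)

  TwoForcers : ℕ → Set
  TwoForcers ℓ = ∀ (L : Subset n) → ∣ L ∣ ≤ ℓ → ∀ (v : Fin n) → v ∉ B →
    ∃[ x ] ∃[ y ] (y ≢ x × InF G L B x v × InF G L B y v)

  specLeaky⇒leaky : ∀ {ℓ} → SpecLeakyForcingSet G (suc ℓ) B → LeakyForcingSet G ℓ B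
  specLeaky⇒leaky spec L |L|≤ℓ with specLeaky⇒mixedLeaky spec L [] (m≤n⇒m≤1+n |L|≤ℓ) []
  ... | fs , proc = fs , dropSpecLeaks proc

  specLeaky⇒twoForcers : ∀ {ℓ} → SpecLeakyForcingSet G (suc ℓ) B → TwoForcers ℓ
  specLeaky⇒twoForcers spec L |L|≤ℓ v v∉B with specLeaky⇒leaky spec L |L|≤ℓ
  ... | fs , proc@(ch , all) with forcerOf (all v) v∉B
  ... | x , x→v with specLeaky⇒mixedLeaky spec L ((x , v) ∷ []) (s≤s |L|≤ℓ) (proj₁ (proj₂ (∈-chain ch x→v)) ∷ [])
  ... | gs , gproc@(gch , gall) with forcerOf (gall v) v∉B
  ... | y , y→v = x , y , y≢x , (fs , proc , x→v) , (gs , dropSpecLeaks gproc , y→v)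
    where
      y≢x : y ≢ x
      y≢x refl = proj₂ (proj₁ (∈-chain gch y→v)) (here refl)

  avoiding⇒specProcess : ∀ {a b S fs} → Process G (NotLeak (sources S)) B fs → ¬ Any (_≡ (a , b)) fs →
    Process G (NotSpecLeak ((a , b) ∷ S)) B fs
  avoiding⇒specProcess {a} {b} {S} {fs} (ch , all) avoids = chain-weaken ch permitted , all
    where
      permitted : ∀ {u w} → Any (_≡ (u , w)) fs → NotSpecLeak ((a , b) ∷ S) u w
      permitted m (here refl) = avoids m
      permitted m (there m′) = proj₁ (∈-chain ch m) (∈-sources m′)

  leaky×twoForcers⇒specLeaky : ∀ {ℓ} → LeakyForcingSet G ℓ B → TwoForcers ℓ → SpecLeakyForcingSet G (suc ℓ) B
  leaky×twoForcers⇒specLeaky leaky _ [] _ _ with leaky ⊥ (≤-trans (≤-reflexive (∣⊥∣≡0 n)) z≤n)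
  ... | fs , ch , all = fs , chain-weaken ch (λ _ ()) , all
  leaky×twoForcers⇒specLeaky leaky two ((a , b) ∷ S) (s≤s |S|≤ℓ) _ with b ∈? B
  ... | yes b∈B with leaky (sources S) (≤-trans (∣sources∣≤length S) |S|≤ℓ)
  ...   | fs , proc = fs , avoiding⇒specProcess proc (λ a→b → proj₂ (proj₂ (∈-chain (proj₁ proc) a→b)) b∈B)
  leaky×twoForcers⇒specLeaky leaky two ((a , b) ∷ S) (s≤s |S|≤ℓ) _ | no b∉B
    with one-of-two-≢ _≟_ (two (sources S) (≤-trans (∣sources∣≤length S) |S|≤ℓ) b b∉B) a
  ... | z , z≢a , fs , proc , z→b =
    fs , avoiding⇒specProcess proc (λ a→b → z≢a (chain-forcer-unique (proj₁ proc) z→b a→b))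

theorem3p1 : ∀ {n} (G : Graph n) (ℓ : ℕ) → 1 ≤ ℓ → (B : Subset n) →
    SpecLeakyForcingSet G ℓ B ⇔
      (LeakyForcingSet G (ℓ ∸ 1) B ×
       (∀ (L : Subset n) → ∣ L ∣ ≤ ℓ ∸ 1 → ∀ (v : Fin n) → v ∉ B →
         ∃[ x ] ∃[ y ] (y ≢ x × InF G L B x v × InF G L B y v)))
theorem3p1 G (suc ℓ) (s≤s z≤n) B =
  mk⇔ (λ spec → specLeaky⇒leaky spec , specLeaky⇒twoForcers spec)
      (λ (leaky , two) → leaky×twoForcers⇒specLeaky leaky two)
  where open Forcing G B
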